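{- Let $G$ be a GSOS language (a finite signature together with a finite set of GSOS rules). Then for all initial transition formulae $F$ and $F'$, it is decidable whether $\models_G F \Rightarrow F'$ holds.
   Context: Initial transition formulae are given by the grammar $F ::= \mathsf{True} \mid x \xrightarrow{a} \mid \neg F \mid F \wedge F$, where $x$ ranges over process variables and $a$ over the finite set of actions $\mathsf{Act}$. A $G$-model is a closed substitution $\sigma$ mapping variables to closed $\Sigma_G$-terms; satisfaction is defined by structural recursion, with $\to_G,\sigma \models x \xrightarrow{a}$ iff $\sigma(x) \xrightarrow{a}_G p$ for some closed term $p$, where $\to_G$ is the transition relation induced by the rules of $G$. Semantic entailment $\models_G F \Rightarrow F'$ holds iff every closed substitution satisfying $F$ also satisfies $F'$. -}

module Defs where

open import Data.Nat using (ℕ)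
open import Data.Fin using (Fin)
open import Data.Empty using (⊥)
open import Data.Unit using (⊤)
open import Data.List using (List; length; lookup)
open import Data.List.Membership.Propositional using (_∈_)
open import Data.Product using (Σ; Σ-syntax; ∃; _×_; proj₁; proj₂)
open import Data.Sum using (_⊎_; [_,_])
open import Relation.Binary.PropositionalEquality using (_≡_)
open import Relation.Nullary using (¬_)

record Signature : Set where
  field
    nOps  : ℕ
    arity : Fin nOps → ℕ
open Signature public

data Term (S : Signature) (V : Set) : Set where
  var : V → Term S V
  app : (f : Fin (nOps S)) → (Fin (arity S f) → Term S V) → Term S V

Closed : Signature → Set
Closed S = Term S ⊥

substT : {S : Signature} {V W : Set} → (V → Term S W) → Term S V → Term S W
substT σ (var x)    = σ x
substT σ (app f ts) = app f (λ i → substT σ (ts i))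

-- A GSOS rule for operator f (actions are Fin nAct):
--   { x_i --a--> y_k | (i , a) = pos[k] }   { x_i -/b-> | (i , b) ∈ neg }
--              f(x_1,...,x_n) --act--> target
-- The variables x_i (Fin (arity f)) and y_k (Fin (length pos)) are distinct
-- by construction; target is a term over these variables.
record Rule (S : Signature) (nAct : ℕ) (f : Fin (nOps S)) : Set where
  field
    pos    : List (Fin (arity S f) × Fin nAct)
    neg    : List (Fin (arity S f) × Fin nAct)
    act    : Fin nAct
    target : Term S (Fin (arity S f) ⊎ Fin (length pos))
open Rule public

record GSOS (nAct : ℕ) : Set where
  field
    sig   : Signature
    rules : (f : Fin (nOps sig)) → List (Rule sig nAct f)
open GSOS public

Step : {nAct : ℕ} (G : GSOS nAct) → Closed (sig G) → Fin nAct → Closed (sig G) → Set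
Step G (var ())
Step G (app f ps) c q =
  Σ[ r ∈ Rule (sig G) _ f ] (r ∈ rules G f) × (act r ≡ c) ×
  (Σ[ ys ∈ (Fin (length (pos r)) → Closed (sig G)) ]
     ((k : Fin (length (pos r))) →
        Step G (ps (proj₁ (lookup (pos r) k))) (proj₂ (lookup (pos r) k)) (ys k))
   × ((k : Fin (length (neg r))) → (q' : Closed (sig G)) →
        ¬ Step G (ps (proj₁ (lookup (neg r) k))) (proj₂ (lookup (neg r) k)) q')
   × (q ≡ substT [ ps , ys ] (target r)))

data Formula (nAct : ℕ) : Set where
  True  : Formula nAct
  _—[_]→ : ℕ → Fin nAct → Formula nAct
  ¬F_   : Formula nAct → Formula nAct
  _∧F_  : Formula nAct → Formula nAct → Formula nAct

_,_⊨_ : {nAct : ℕ} (G : GSOS nAct) → (ℕ → Closed (sig G)) → Formula nAct → Set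
G , σ ⊨ True       = ⊤
G , σ ⊨ (x —[ a ]→) = ∃ λ p → Step G (σ x) a p
G , σ ⊨ (¬F F)     = ¬ (G , σ ⊨ F)
G , σ ⊨ (F ∧F F')  = (G , σ ⊨ F) × (G , σ ⊨ F')

Entails : {nAct : ℕ} (G : GSOS nAct) → Formula nAct → Formula nAct → Set
Entails G F F' = (σ : ℕ → Closed (sig G)) → G , σ ⊨ F → G , σ ⊨ F'

-- Satisfaction of an initial transition formula depends, for each variable
-- x, only on the set of actions σ(x) can perform initially, and for GSOS
-- this initial action set is compositional: that of f(p₁,…,pₙ) is Φ_f of
-- those of the pᵢ, since rule premises only test whether arguments can or
-- cannot perform actions.  Hence (1) the action sets realised by closed
-- terms form the least set closed under Φ, reached by iterating Φ from ∅
-- within finitely many steps (there are finitely many action sets), so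
-- realisability is decidable; and (2) ⊨_G F ⇒ F' holds iff F ⇒ F' holds for
-- every assignment of realisable action sets to the finitely many variables
-- of F and F', a finite check.

module Submission where

open import Defs
open import Data.Nat using (ℕ; zero; suc; _≤_; _<_; z≤n; s≤s; _⊔_)
open import Data.Nat.Properties
  using (≤-refl; ≤-<-trans; <-≤-trans; m≤n⇒m≤1+n; m≤m⊔n; m≤n⊔m; n≮n)
open import Data.Bool using (Bool; true; false; T; _∨_; if_then_else_)
open import Data.Bool.Properties using (T-∨) renaming (_≟_ to _≟ᵇ_)
open import Data.Fin using (Fin; toℕ) renaming (zero to fzero; suc to fsuc; _≟_ to _≟ᶠ_)
import Data.Fin.Properties as Fin
open import Data.Vec using (Vec; []; _∷_; lookup; tabulate)
open import Data.Vec.Properties using (lookup∘tabulate; tabulate∘lookup; tabulate-cong; ≡-dec)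
open import Data.List using (List; []; _∷_; length; cartesianProductWith)
import Data.List as List
open import Data.List.Relation.Unary.Any as Any using (Any; here; there)
import Data.List.Relation.Unary.All as All
open import Data.List.Membership.Propositional using (_∈_; find; lose)
open import Data.List.Membership.Propositional.Properties using (∈-cartesianProductWith⁺)
open import Data.Product using (Σ-syntax; ∃; _×_; _,_; proj₁; proj₂; uncurry)
import Data.Product as Product
open import Data.Product.Function.NonDependent.Propositional using (_×-⇔_)
open import Data.Sum using (_⊎_; inj₁; inj₂; [_,_])
open import Data.Empty using (⊥-elim)
open import Data.Unit using (⊤; tt)
open import Function using (_∘_; _⇔_; mk⇔; Equivalence)
open import Function.Construct.Composition using (_⇔-∘_)
open import Function.Construct.Symmetry using (⇔-sym)
open import Function.Construct.Identity using (⇔-id)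
open import Function.Related.TypeIsomorphisms using (¬-cong-⇔)
open import Relation.Nullary using (Dec; yes; no; ¬_; ¬?)
open import Relation.Nullary.Decidable
  using (isYes; toWitness; fromWitness; T?; _×-dec_; _→-dec_; decidable-stable)
  renaming (map to decMap; map′ to decMap′)
open import Relation.Unary using (Decidable)
open import Relation.Binary.PropositionalEquality
  using (_≡_; refl; sym; trans; cong; cong₂; subst)

open Equivalence using (to; from)

Enumeration : Set → Set
Enumeration A = Σ[ xs ∈ List A ] (∀ x → x ∈ xs)

module _ {A : Set} (E : Enumeration A) where

  ∃? : {P : A → Set} → Decidable P → Dec (∃ P)
  ∃? P? = decMap′ Any.satisfied (λ (x , px) → lose (proj₂ E x) px) (Any.any? P? (proj₁ E))

  ∀? : {P : A → Set} → Decidable P → Dec (∀ x → P x)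
  ∀? P? = decMap′ (λ all x → All.lookup all (proj₂ E x)) (λ h → All.tabulate (λ {x} _ → h x))
                  (All.all? P? (proj₁ E))

enumBool : Enumeration Bool
enumBool = true ∷ false ∷ [] , λ { true → here refl ; false → there (here refl) }

vectors : {A : Set} → List A → (n : ℕ) → List (Vec A n)
vectors xs zero    = [] ∷ []
vectors xs (suc n) = cartesianProductWith _∷_ xs (vectors xs n)

enumVec : {A : Set} → Enumeration A → (n : ℕ) → Enumeration (Vec A n)
enumVec {A} (xs , xs-complete) n = vectors xs n , complete
  where
  complete : ∀ {n} (v : Vec A n) → v ∈ vectors xs n
  complete []      = here refl
  complete (x ∷ v) = ∈-cartesianProductWith⁺ _∷_ (xs-complete x) (complete v)

_⊆ᵇ_ : {A : Set} → (A → Bool) → (A → Bool) → Set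
P ⊆ᵇ Q = ∀ x → T (P x) → T (Q x)

count : {A : Set} → (A → Bool) → List A → ℕ
count P []       = 0
count P (x ∷ xs) = if P x then suc (count P xs) else count P xs

count≤length : {A : Set} (P : A → Bool) (xs : List A) → count P xs ≤ length xs
count≤length P []       = z≤n
count≤length P (x ∷ xs) with P x
... | true  = s≤s (count≤length P xs)
... | false = m≤n⇒m≤1+n (count≤length P xs)

count-mono : {A : Set} {P Q : A → Bool} → P ⊆ᵇ Q → (xs : List A) → count P xs ≤ count Q xs
count-mono P⊆Q []       = z≤n
count-mono {P = P} {Q} P⊆Q (x ∷ xs) with P x | Q x | P⊆Q x
... | true  | true  | _    = s≤s (count-mono P⊆Q xs)
... | true  | false | P⇒Q = ⊥-elim (P⇒Q tt)
... | false | true  | _    = m≤n⇒m≤1+n (count-mono P⊆Q xs)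
... | false | false | _    = count-mono P⊆Q xs

count-strict : {A : Set} {P Q : A → Bool} → P ⊆ᵇ Q → {x : A} {xs : List A} →
               x ∈ xs → T (Q x) → ¬ T (P x) → count P xs < count Q xs
count-strict {P = P} {Q} P⊆Q {xs = y ∷ xs} (here refl) Qy ¬Py with P y | Q y
... | true  | _     = ⊥-elim (¬Py tt)
... | false | true  = s≤s (count-mono P⊆Q xs)
count-strict {P = P} {Q} P⊆Q {xs = y ∷ xs} (there x∈xs) Qx ¬Px with P y | Q y | P⊆Q y
... | true  | true  | _    = s≤s (count-strict P⊆Q x∈xs Qx ¬Px)
... | true  | false | P⇒Q = ⊥-elim (P⇒Q tt)
... | false | true  | _    = m≤n⇒m≤1+n (count-strict P⊆Q x∈xs Qx ¬Px)
... | false | false | _    = count-strict P⊆Q x∈xs Qx ¬Px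

-- An increasing chain of subsets of an enumerated type stops growing at some
-- stage: while it grows, stage k has at least k elements, which is
-- impossible beyond the size of the enumeration.
module _ {A : Set} (E : Enumeration A) (P : ℕ → A → Bool)
         (increasing : ∀ k → P k ⊆ᵇ P (suc k)) where

  private
    grows-or-stops : ∀ k → k ≤ count (P k) (proj₁ E) ⊎ ∃ λ j → P (suc j) ⊆ᵇ P j
    grows-or-stops zero = inj₁ z≤n
    grows-or-stops (suc k) with grows-or-stops k
    ... | inj₂ stable = inj₂ stable
    ... | inj₁ k≤count with ∃? E (λ x → T? (P (suc k) x) ×-dec ¬? (T? (P k x)))
    ...   | yes (x , new , ¬old) =
            inj₁ (≤-<-trans k≤count (count-strict (increasing k) (proj₂ E x) new ¬old))
    ...   | no nothing-new =
            inj₂ (k , λ x new → decidable-stable (T? (P k x)) (λ ¬old → nothing-new (x , new , ¬old)))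

  stabilises : ∃ λ k → P (suc k) ⊆ᵇ P k
  stabilises with grows-or-stops (suc (length (proj₁ E)))
  ... | inj₂ stable = stable
  ... | inj₁ too-big =
        ⊥-elim (n≮n _ (≤-<-trans too-big (s≤s (count≤length (P (suc (length (proj₁ E)))) (proj₁ E)))))

clamp : {m : ℕ} → ℕ → Fin (suc m)
clamp {zero}  _       = fzero
clamp {suc m} zero    = fzero
clamp {suc m} (suc x) = fsuc (clamp x)

toℕ-clamp : {m : ℕ} (x : ℕ) → x < suc m → toℕ (clamp {m} x) ≡ x
toℕ-clamp {zero}  zero    _             = refl
toℕ-clamp {zero}  (suc x) (s≤s ())
toℕ-clamp {suc m} zero    _             = refl
toℕ-clamp {suc m} (suc x) (s≤s x<suc-m) = cong suc (toℕ-clamp x x<suc-m)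

ActSet : ℕ → Set
ActSet nAct = Vec Bool nAct

enumActSet : (nAct : ℕ) → Enumeration (ActSet nAct)
enumActSet = enumVec enumBool

_∋_ : {nAct : ℕ} → ActSet nAct → Fin nAct → Set
S ∋ a = T (lookup S a)

∋-cong : {nAct : ℕ} {S S' : ActSet nAct} (a : Fin nAct) → S ≡ S' → S ∋ a ⇔ S' ∋ a
∋-cong a refl = ⇔-id _

valuation : {nAct m : ℕ} → Vec (ActSet nAct) (suc m) → ℕ → ActSet nAct
valuation v x = lookup v (clamp x)

infix 4 _⊨ᵃ_
_⊨ᵃ_ : {nAct : ℕ} → (ℕ → ActSet nAct) → Formula nAct → Set
ρ ⊨ᵃ True        = ⊤
ρ ⊨ᵃ (x —[ a ]→) = ρ x ∋ a
ρ ⊨ᵃ (¬F F)      = ¬ (ρ ⊨ᵃ F)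
ρ ⊨ᵃ (F ∧F F')   = ρ ⊨ᵃ F × ρ ⊨ᵃ F'

⊨ᵃ? : {nAct : ℕ} (ρ : ℕ → ActSet nAct) (F : Formula nAct) → Dec (ρ ⊨ᵃ F)
⊨ᵃ? ρ True        = yes tt
⊨ᵃ? ρ (x —[ a ]→) = T? (lookup (ρ x) a)
⊨ᵃ? ρ (¬F F)      = ¬? (⊨ᵃ? ρ F)
⊨ᵃ? ρ (F ∧F F')   = ⊨ᵃ? ρ F ×-dec ⊨ᵃ? ρ F'

bound : {nAct : ℕ} → Formula nAct → ℕ
bound True        = 0
bound (x —[ a ]→) = suc x
bound (¬F F)      = bound F
bound (F ∧F F')   = bound F ⊔ bound F'

⊨ᵃ-local : {nAct : ℕ} {ρ ρ' : ℕ → ActSet nAct} (F : Formula nAct) →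
           (∀ x → x < bound F → ρ x ≡ ρ' x) → (ρ ⊨ᵃ F) ≡ (ρ' ⊨ᵃ F)
⊨ᵃ-local True        agree = refl
⊨ᵃ-local (x —[ a ]→) agree = cong (_∋ a) (agree x (s≤s ≤-refl))
⊨ᵃ-local (¬F F)      agree = cong ¬_ (⊨ᵃ-local F agree)
⊨ᵃ-local (F ∧F F')   agree =
  cong₂ _×_ (⊨ᵃ-local F  (λ x lt → agree x (<-≤-trans lt (m≤m⊔n (bound F) (bound F')))))
            (⊨ᵃ-local F' (λ x lt → agree x (<-≤-trans lt (m≤n⊔m (bound F) (bound F')))))

⊨ᵃ-transport : {nAct : ℕ} {ρ ρ' : ℕ → ActSet nAct} (F : Formula nAct) →
               (∀ x → x < bound F → ρ x ≡ ρ' x) → ρ ⊨ᵃ F → ρ' ⊨ᵃ F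
⊨ᵃ-transport F agree = subst (λ X → X) (⊨ᵃ-local F agree)

module _ {nAct : ℕ} (G : GSOS nAct) where

  private
    Sg : Signature
    Sg = sig G

  Premises : {f : Fin (nOps Sg)} → Rule Sg nAct f → (Fin (arity Sg f) → Fin nAct → Set) → Set
  Premises r C = (∀ k → uncurry C (List.lookup (pos r) k))
               × (∀ k → ¬ uncurry C (List.lookup (neg r) k))

  Fires : (f : Fin (nOps Sg)) → (Fin (arity Sg f) → Fin nAct → Set) → Fin nAct → Set
  Fires f C a = Any (λ r → act r ≡ a × Premises r C) (rules G f)

  fires-cong : {f : Fin (nOps Sg)} {C D : Fin (arity Sg f) → Fin nAct → Set} {a : Fin nAct} →
               (∀ i b → C i b ⇔ D i b) → Fires f C a ⇔ Fires f D a
  fires-cong C⇔D = mk⇔ (Any.map (λ {r} → Product.map₂ (premises {r = r} C⇔D)))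
                       (Any.map (λ {r} → Product.map₂ (premises {r = r} (λ i b → ⇔-sym (C⇔D i b)))))
    where
    premises : ∀ {f} {C D : Fin (arity Sg f) → Fin nAct → Set} {r : Rule Sg nAct f} →
               (∀ i b → C i b ⇔ D i b) → Premises r C → Premises r D
    premises C⇔D (pos-hold , neg-fail) =
      (λ k → to (C⇔D _ _) (pos-hold k)) , (λ k d → neg-fail k (from (C⇔D _ _) d))

  fires? : (f : Fin (nOps Sg)) {C : Fin (arity Sg f) → Fin nAct → Set} →
           (∀ i b → Dec (C i b)) → (a : Fin nAct) → Dec (Fires f C a)
  fires? f C? a = Any.any? (λ r → (act r ≟ᶠ a) ×-dec
                                  (Fin.all? (λ k → uncurry C? (List.lookup (pos r) k))) ×-dec
                                  (Fin.all? (λ k → ¬? (uncurry C? (List.lookup (neg r) k)))))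
                           (rules G f)

  CanDo : Closed Sg → Fin nAct → Set
  CanDo t a = ∃ (Step G t a)

  canDo-app : (f : Fin (nOps Sg)) (ps : Fin (arity Sg f) → Closed Sg) (a : Fin nAct) →
              CanDo (app f ps) a ⇔ Fires f (λ i → CanDo (ps i)) a
  canDo-app f ps a = mk⇔ fires fired
    where
    fires : CanDo (app f ps) a → Fires f (λ i → CanDo (ps i)) a
    fires (_ , r , r∈ , act≡a , ys , pos-steps , neg-fail , _) =
      lose r∈ (act≡a , (λ k → ys k , pos-steps k) , λ k (q , step) → neg-fail k q step)
    fired : Fires f (λ i → CanDo (ps i)) a → CanDo (app f ps) a
    fired any with find any
    ... | r , r∈ , act≡a , pos-hold , neg-fail =
      substT [ ps , proj₁ ∘ pos-hold ] (target r) ,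
      r , r∈ , act≡a , proj₁ ∘ pos-hold , proj₂ ∘ pos-hold , (λ k q step → neg-fail k (q , step)) , refl

  firesOn? : (f : Fin (nOps Sg)) (Ss : Vec (ActSet nAct) (arity Sg f)) (a : Fin nAct) →
             Dec (Fires f (λ i → lookup Ss i ∋_) a)
  firesOn? f Ss = fires? f (λ i b → T? (lookup (lookup Ss i) b))

  Φ : (f : Fin (nOps Sg)) → Vec (ActSet nAct) (arity Sg f) → ActSet nAct
  Φ f Ss = tabulate (λ a → isYes (firesOn? f Ss a))

  Φ-spec : (f : Fin (nOps Sg)) (Ss : Vec (ActSet nAct) (arity Sg f)) (a : Fin nAct) →
           Φ f Ss ∋ a ⇔ Fires f (λ i → lookup Ss i ∋_) a
  Φ-spec f Ss a = mk⇔
    (λ h → toWitness {a? = firesOn? f Ss a} (subst T (lookup∘tabulate fires-bit a) h))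
    (λ h → subst T (sym (lookup∘tabulate fires-bit a)) (fromWitness {a? = firesOn? f Ss a} h))
    where
    fires-bit : Fin nAct → Bool
    fires-bit b = isYes (firesOn? f Ss b)

  initials : Closed Sg → ActSet nAct
  initials (var ())
  initials (app f ps) = Φ f (tabulate (λ i → initials (ps i)))

  initials-correct : (t : Closed Sg) (a : Fin nAct) → initials t ∋ a ⇔ CanDo t a
  initials-correct (var ())  a
  initials-correct (app f ps) a =
    ⇔-sym (canDo-app f ps a) ⇔-∘ (fires-cong arguments-correct ⇔-∘ Φ-spec f Ss a)
    where
    Ss : Vec (ActSet nAct) (arity Sg f)
    Ss = tabulate (λ i → initials (ps i))
    arguments-correct : ∀ i b → lookup Ss i ∋ b ⇔ CanDo (ps i) b
    arguments-correct i b =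
      initials-correct (ps i) b ⇔-∘ ∋-cong b (lookup∘tabulate (λ i → initials (ps i)) i)

  ⊨⇔⊨ᵃ : (σ : ℕ → Closed Sg) (F : Formula nAct) → G , σ ⊨ F ⇔ (λ x → initials (σ x)) ⊨ᵃ F
  ⊨⇔⊨ᵃ σ True        = ⇔-id _
  ⊨⇔⊨ᵃ σ (x —[ a ]→) = ⇔-sym (initials-correct (σ x) a)
  ⊨⇔⊨ᵃ σ (¬F F)      = ¬-cong-⇔ (⊨⇔⊨ᵃ σ F)
  ⊨⇔⊨ᵃ σ (F ∧F F')   = ⊨⇔⊨ᵃ σ F ×-⇔ ⊨⇔⊨ᵃ σ F'

  Realisable : ActSet nAct → Set
  Realisable S = ∃ λ t → initials t ≡ S

  Produces : (ActSet nAct → Bool) → ActSet nAct → Set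
  Produces R S = ∃ λ f → ∃ λ (Ss : Vec (ActSet nAct) (arity Sg f)) →
                   (∀ i → T (R (lookup Ss i))) × Φ f Ss ≡ S

  produces? : (R : ActSet nAct → Bool) → Decidable (Produces R)
  produces? R S = Fin.any? λ f → ∃? (enumVec (enumActSet nAct) (arity Sg f)) λ Ss →
                    Fin.all? (λ i → T? (R (lookup Ss i))) ×-dec ≡-dec _≟ᵇ_ (Φ f Ss) S

  -- Stage k of iterating Φ from ∅: the initial action sets of the closed
  -- terms of height < k.
  realisedBy : ℕ → ActSet nAct → Bool
  realisedBy zero    S = false
  realisedBy (suc k) S = realisedBy k S ∨ isYes (produces? (realisedBy k) S)

  realisedBy-increasing : ∀ k → realisedBy k ⊆ᵇ realisedBy (suc k)
  realisedBy-increasing k S h = from T-∨ (inj₁ h)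

  realisedBy-sound : ∀ k S → T (realisedBy k S) → Realisable S
  realisedBy-sound (suc k) S h with to (T-∨ {realisedBy k S}) h
  ... | inj₁ earlier = realisedBy-sound k S earlier
  ... | inj₂ produced with toWitness {a? = produces? (realisedBy k) S} produced
  ...   | f , Ss , from-earlier , refl =
          app f (λ i → proj₁ (argument i)) ,
          cong (Φ f) (trans (tabulate-cong (λ i → proj₂ (argument i))) (tabulate∘lookup Ss))
    where
    argument : ∀ i → Realisable (lookup Ss i)
    argument i = realisedBy-sound k (lookup Ss i) (from-earlier i)

  closingStage : ∃ λ k → realisedBy (suc k) ⊆ᵇ realisedBy k
  closingStage = stabilises (enumActSet nAct) realisedBy realisedBy-increasing

  realisedBy-complete : ∀ t → T (realisedBy (proj₁ closingStage) (initials t))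
  realisedBy-complete (var ())
  realisedBy-complete (app f ps) =
    proj₂ closingStage _ (from T-∨ (inj₂ (fromWitness {a? = produces? R (Φ f Ss)} produced)))
    where
    R : ActSet nAct → Bool
    R = realisedBy (proj₁ closingStage)
    Ss : Vec (ActSet nAct) (arity Sg f)
    Ss = tabulate (λ i → initials (ps i))
    produced : Produces R (Φ f Ss)
    produced = f , Ss , (λ i → subst (T ∘ R) (sym (lookup∘tabulate (λ i → initials (ps i)) i))
                                      (realisedBy-complete (ps i))) , refl

  realisable? : Decidable Realisable
  realisable? S = decMap (mk⇔ (realisedBy-sound k S) (λ { (t , refl) → realisedBy-complete t }))
                         (T? (realisedBy k S))
    where k = proj₁ closingStage

  -- Entailment checked only on realisable action sets for the variables
  -- 0..m, the remaining variables sharing the action set of variable m.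
  RealisablyEntails : (m : ℕ) → Formula nAct → Formula nAct → Set
  RealisablyEntails m F F' = (v : Vec (ActSet nAct) (suc m)) → (∀ i → Realisable (lookup v i)) →
                             valuation v ⊨ᵃ F → valuation v ⊨ᵃ F'

  realisablyEntails? : (m : ℕ) (F F' : Formula nAct) → Dec (RealisablyEntails m F F')
  realisablyEntails? m F F' = ∀? (enumVec (enumActSet nAct) (suc m)) λ v →
    Fin.all? (λ i → realisable? (lookup v i)) →-dec (⊨ᵃ? (valuation v) F →-dec ⊨ᵃ? (valuation v) F')

  entails⇔realisablyEntails : {m : ℕ} (F F' : Formula nAct) → bound F ≤ suc m → bound F' ≤ suc m →
                              Entails G F F' ⇔ RealisablyEntails m F F'
  entails⇔realisablyEntails {m} F F' F≤ F'≤ = mk⇔ restrict extend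
    where
    restrict : Entails G F F' → RealisablyEntails m F F'
    restrict E v realisable v⊨F =
      ⊨ᵃ-transport F' (λ x _ → realises x)
        (to (⊨⇔⊨ᵃ σ F') (E σ (from (⊨⇔⊨ᵃ σ F) (⊨ᵃ-transport F (λ x _ → sym (realises x)) v⊨F))))
      where
      σ : ℕ → Closed Sg
      σ x = proj₁ (realisable (clamp x))
      realises : ∀ x → initials (σ x) ≡ valuation v x
      realises x = proj₂ (realisable (clamp x))

    extend : RealisablyEntails m F F' → Entails G F F'
    extend R σ σ⊨F =
      from (⊨⇔⊨ᵃ σ F') (⊨ᵃ-transport F' (λ x x< → agree x (<-≤-trans x< F'≤))
        (R v realisable (⊨ᵃ-transport F (λ x x< → sym (agree x (<-≤-trans x< F≤)))
          (to (⊨⇔⊨ᵃ σ F) σ⊨F))))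
      where
      v : Vec (ActSet nAct) (suc m)
      v = tabulate (λ i → initials (σ (toℕ i)))
      agree : ∀ x → x < suc m → valuation v x ≡ initials (σ x)
      agree x x< = trans (lookup∘tabulate (λ i → initials (σ (toℕ i))) (clamp x))
                         (cong (λ y → initials (σ y)) (toℕ-clamp x x<))
      realisable : ∀ i → Realisable (lookup v i)
      realisable i = σ (toℕ i) , sym (lookup∘tabulate (λ i → initials (σ (toℕ i))) i)

theorem4p1 : {nAct : ℕ} (G : GSOS nAct) (F F' : Formula nAct) → Dec (Entails G F F')
theorem4p1 G F F' =
  decMap (⇔-sym (entails⇔realisablyEntails G F F' F≤ F'≤)) (realisablyEntails? G m F F')
  where
  m : ℕ
  m = bound F ⊔ bound F'
  F≤ : bound F ≤ suc m
  F≤ = m≤n⇒m≤1+n (m≤m⊔n (bound F) (bound F'))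
  F'≤ : bound F' ≤ suc m
  F'≤ = m≤n⇒m≤1+n (m≤n⊔m (bound F) (bound F'))
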